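{- Let $k \geq 2$ be an integer. If $n \geq (k+2)^k$ is an integer, then $$c(n,k) \leq k \lceil n^{1/k} \rceil + k^2.$$
   Context: For an integer $n$, $C_n$ denotes the cycle with vertex set $\{1,2,\dots,n\}$ and edges $\{i,i+1\}$ for $1 \leq i \leq n-1$ together with $\{n,1\}$. A chord of $C_n$ is an edge joining two non-adjacent vertices of $C_n$. For integers $n \geq 6$ and $k \geq 2$, $c(n,k)$ denotes the minimum number of chords that must be added to $C_n$ so that the resulting graph has the property that for every integer $l \in \{k, k+1, \dots, n\}$ there is a cycle of length $l$ containing exactly $k$ of the added chords. -}

module Defs where

open import Data.Nat using (ℕ; zero; suc; _+_; _*_; _^_; _≤_; _<_; _≡ᵇ_)
open import Data.Bool using (Bool; true; false; _∧_; _∨_; if_then_else_)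
open import Data.List using (List; []; _∷_; _++_; [_]; zip; length)
open import Data.Product using (_×_; _,_; proj₁; proj₂; ∃)
open import Data.Sum using (_⊎_)
open import Relation.Binary.PropositionalEquality using (_≡_)
open import Relation.Nullary using (¬_)
open import Data.List.Relation.Unary.All using (All)
open import Data.List.Relation.Unary.Unique.Propositional using (Unique)
open import Data.List.Membership.Propositional using (_∈_)

InV : ℕ → ℕ → Set
InV n v = 1 ≤ v × v ≤ n

CycleAdj : ℕ → ℕ → ℕ → Set
CycleAdj n u v =
  InV n u × InV n v ×
  (v ≡ suc u ⊎ u ≡ suc v ⊎ (u ≡ n × v ≡ 1) ⊎ (u ≡ 1 × v ≡ n))

IsChord : ℕ → ℕ × ℕ → Set
IsChord n (a , b) = InV n a × InV n b × a < b × ¬ CycleAdj n a b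

ChordSet : ℕ → List (ℕ × ℕ) → Set
ChordSet n S = Unique S × All (IsChord n) S

InS : List (ℕ × ℕ) → ℕ → ℕ → Set
InS S u v = (u , v) ∈ S ⊎ (v , u) ∈ S

Adj : ℕ → List (ℕ × ℕ) → ℕ → ℕ → Set
Adj n S u v = CycleAdj n u v ⊎ InS S u v

cycEdges : List ℕ → List (ℕ × ℕ)
cycEdges [] = []
cycEdges (x ∷ xs) = zip (x ∷ xs) (xs ++ [ x ])

IsCycle : ℕ → List (ℕ × ℕ) → List ℕ → Set
IsCycle n S vs =
  3 ≤ length vs × Unique vs × All (InV n) vs ×
  All (λ e → Adj n S (proj₁ e) (proj₂ e)) (cycEdges vs)

pairEqB : ℕ × ℕ → ℕ × ℕ → Bool
pairEqB (a , b) (c , d) = (a ≡ᵇ c) ∧ (b ≡ᵇ d)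

memB : ℕ × ℕ → List (ℕ × ℕ) → Bool
memB e [] = false
memB e (x ∷ S) = pairEqB e x ∨ memB e S

isChordEdgeB : List (ℕ × ℕ) → ℕ × ℕ → Bool
isChordEdgeB S (u , v) = memB (u , v) S ∨ memB (v , u) S

countB : {A : Set} → (A → Bool) → List A → ℕ
countB p [] = 0
countB p (x ∷ xs) = if p x then suc (countB p xs) else countB p xs

chordsUsed : List (ℕ × ℕ) → List ℕ → ℕ
chordsUsed S vs = countB (isChordEdgeB S) (cycEdges vs)

-- For every l in {k,...,n} (with l ≥ 3, as cycles have length ≥ 3) there is a
-- cycle of length l containing exactly k of the added chords.
Good : ℕ → ℕ → List (ℕ × ℕ) → Set
Good n k S =
  ∀ l → k ≤ l → 3 ≤ l → l ≤ n →
  ∃ λ vs → IsCycle n S vs × length vs ≡ l × chordsUsed S vs ≡ k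

-- c(n,k) ≤ B : some admissible set of at most B chords exists
-- (c(n,k) is the minimum size of such a set).
cLe : ℕ → ℕ → ℕ → Set
cLe n k B = ∃ λ S → ChordSet n S × Good n k S × length S ≤ B

-- m = ⌈ n^(1/k) ⌉ : the least m with n ≤ m^k
IsCeilRoot : ℕ → ℕ → ℕ → Set
IsCeilRoot n k m = n ≤ m ^ k × (∀ j → n ≤ j ^ k → m ≤ j)

-- Write k = q + 1 and let the anchors be a_j = m^j + 2j for j ≤ q, so a_0 = 1. Add the chords
-- {a_j + c·m^j, a_(j+1)} for j < q and c < m, the chords {1, a_q + e} for the m top offsets
-- e ∈ {c·m^q : c < m - 1} ∪ {n - 1 - a_q}, and a ladder of 2k - 1 chords. A cycle climbing from 1
-- through the levels and returning from a_q + e to 1 uses k chords and has length k + r + e, where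
-- r < m^q is any number written with q digits in base m; since n ≤ m^k, every length k ≤ l ≤ n - k arises.
-- For n - k < l ≤ n the cycle 1 2 4 3 6 5 … 2q 2q-1 n n-1 … σ, with σ = n - l + 2k - 1, uses the ladder.
-- These are km + 2k - 1 ≤ km + k² chords. The levels fit below n because m = ⌈n^(1/k)⌉ ≥ k + 2 gives
-- (m - 1)^k ≥ m^(k-1)(m - k) ≥ 2m^(k-1) ≥ a_q, while (m - 1)^k < n by minimality of m.

module Submission where

open import Defs
open import Data.Bool using (Bool; true; false; T)
open import Data.Bool.Properties using (T-∧; T-∨)
open import Data.Empty using (⊥-elim)
open import Data.List using (List; []; _∷_; _++_; [_]; zip; length; map; filter; deduplicate; cartesianProductWith; applyUpTo; upTo)
open import Data.Nat.ListAction using (sum)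
open import Data.List.Properties using (++-assoc; length-++; length-map; length-filter; length-deduplicate; length-applyUpTo; length-upTo)
open import Data.List.Membership.Propositional using (_∈_)
open import Data.List.Membership.Propositional.Properties
  using (∈-filter⁺; ∈-++⁺ˡ; ∈-++⁺ʳ; ∈-cartesianProductWith⁺; ∈-applyUpTo⁺; ∈-upTo⁺)
open import Data.List.Relation.Unary.All as All using (All; []; _∷_)
open import Data.List.Relation.Unary.Any using (here; there)
open import Data.List.Relation.Unary.AllPairs using ([]; _∷_)
import Data.List.Relation.Unary.AllPairs.Properties as AllPairs
import Data.List.Relation.Unary.All.Properties as All
open import Data.List.Relation.Unary.Unique.Propositional using (Unique)
import Data.List.Relation.Unary.Unique.DecPropositional.Properties as Unique
import Data.List.Relation.Unary.Any.Properties as Any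
open import Data.Nat using (ℕ; zero; suc; _+_; _*_; _^_; _∸_; _≤_; _<_; z≤n; s≤s; _≟_; _≤?_; _<?_; NonZero; >-nonZero)
open import Data.Nat.DivMod using (_/_; _%_; m≡m%n+[m/n]*n; m%n<n; m/n*n≤m; m<n*o⇒m/o<n)
open import Data.Nat.Tactic.RingSolver using (solve-∀)
open import Data.Nat.Properties
open import Data.Product using (_×_; _,_; proj₁; proj₂; ∃)
open import Data.Product.Properties using (≡-dec)
open import Data.Sum as Sum using (_⊎_; inj₁; inj₂)
open import Data.Unit using (⊤; tt)
open import Function using (_∘_; _∘′_)
open import Function.Bundles using (Equivalence)
open import Relation.Binary.PropositionalEquality using (_≡_; refl; sym; trans; cong; cong₂; subst; subst₂; module ≡-Reasoning)
open import Relation.Nullary using (¬_; Dec; yes; no)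
open import Relation.Nullary.Decidable using (_×-dec_; _⊎-dec_; ¬?)

open Equivalence using (to; from)

pairEqB-sound : ∀ e f → T (pairEqB e f) → e ≡ f
pairEqB-sound (a , b) (c , d) t = cong₂ _,_ (≡ᵇ⇒≡ a c (proj₁ eqs)) (≡ᵇ⇒≡ b d (proj₂ eqs))
  where eqs = to T-∧ t

pairEqB-refl : ∀ e → T (pairEqB e e)
pairEqB-refl (a , b) = from T-∧ (≡⇒≡ᵇ a a refl , ≡⇒≡ᵇ b b refl)

memB-sound : ∀ e S → T (memB e S) → e ∈ S
memB-sound e (f ∷ S) t = Sum.[ here ∘′ pairEqB-sound e f , there ∘′ memB-sound e S ] (to T-∨ t)

memB-complete : ∀ {e S} → e ∈ S → T (memB e S)
memB-complete {e} (here refl) = from T-∨ (inj₁ (pairEqB-refl e))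
memB-complete (there p) = from T-∨ (inj₂ (memB-complete p))

isChordEdgeB-sound : ∀ S u v → T (isChordEdgeB S (u , v)) → InS S u v
isChordEdgeB-sound S u v t = Sum.map (memB-sound _ S) (memB-sound _ S) (to T-∨ t)

isChordEdgeB-complete : ∀ {S u v} → InS S u v → T (isChordEdgeB S (u , v))
isChordEdgeB-complete p = from T-∨ (Sum.map memB-complete memB-complete p)

countB-yes : ∀ {A : Set} (p : A → Bool) {x} xs → T (p x) → countB p (x ∷ xs) ≡ suc (countB p xs)
countB-yes p {x} xs t with p x
... | true = refl

countB-no : ∀ {A : Set} (p : A → Bool) {x} xs → ¬ T (p x) → countB p (x ∷ xs) ≡ countB p xs
countB-no p {x} xs ¬t with p x
... | true = ⊥-elim (¬t _)
... | false = refl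

Gap : ℕ × ℕ → Set
Gap (a , b) = suc a < b

InS-sym : ∀ {S u v} → InS S u v → InS S v u
InS-sym = Sum.swap

consecutive-notInS : ∀ {S} → All Gap S → ∀ u → ¬ InS S u (suc u)
consecutive-notInS gaps u (inj₁ p) = <-irrefl refl (All.lookup gaps p)
consecutive-notInS gaps u (inj₂ p) = <⇒≱ (All.lookup gaps p) (m≤n+m u 2)

pathEdges : ℕ → List ℕ → List (ℕ × ℕ)
pathEdges x [] = []
pathEdges x (y ∷ ys) = (x , y) ∷ pathEdges y ys

cycEdges-pathEdges : ∀ x xs → cycEdges (x ∷ xs) ≡ pathEdges x (xs ++ [ x ])
cycEdges-pathEdges x = zip≡pathEdges x
  where
  zip≡pathEdges : ∀ y ys → zip (y ∷ ys) (ys ++ [ x ]) ≡ pathEdges y (ys ++ [ x ])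
  zip≡pathEdges y [] = refl
  zip≡pathEdges y (z ∷ zs) = cong ((y , z) ∷_) (zip≡pathEdges z zs)

-- up a k is the run a, a+1, …, k+a and down a k the run k+a, …, a+1, a.
data Run : Set where
  up down : ℕ → ℕ → Run

ascent : ℕ → ℕ → List ℕ
ascent a zero = []
ascent a (suc k) = suc a ∷ ascent (suc a) k

descent : ℕ → ℕ → List ℕ
descent a zero = []
descent a (suc k) = k + a ∷ descent a k

low extent start end : Run → ℕ
low (up a k) = a
low (down a k) = a
extent (up a k) = k
extent (down a k) = k
start (up a k) = a
start (down a k) = k + a
end (up a k) = k + a
end (down a k) = a

high size : Run → ℕ
high r = extent r + low r
size r = suc (extent r)

rest : Run → List ℕ
rest (up a k) = ascent a k
rest (down a k) = descent a k

vertices : Run → List ℕ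
vertices r = start r ∷ rest r

catRuns : List Run → List ℕ → List ℕ
catRuns [] t = t
catRuns (r ∷ rs) t = start r ∷ (rest r ++ catRuns rs t)

tour : List Run → List ℕ
tour rs = catRuns rs []

catRuns-++ : ∀ rs t u → catRuns rs t ++ u ≡ catRuns rs (t ++ u)
catRuns-++ [] t u = refl
catRuns-++ (r ∷ rs) t u =
  cong (start r ∷_) (trans (++-assoc (rest r) (catRuns rs t) u) (cong (rest r ++_) (catRuns-++ rs t u)))

cycEdges-tour : ∀ r rs → cycEdges (tour (r ∷ rs)) ≡ pathEdges (start r) (rest r ++ catRuns rs [ start r ])
cycEdges-tour r rs = trans (cycEdges-pathEdges (start r) (rest r ++ tour rs))
  (cong (pathEdges (start r)) (trans (++-assoc (rest r) (tour rs) _) (cong (rest r ++_) (catRuns-++ rs [] _))))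

length-rest : ∀ r → length (rest r) ≡ extent r
length-rest (up a k) = length-ascent a k
  where
  length-ascent : ∀ a k → length (ascent a k) ≡ k
  length-ascent a zero = refl
  length-ascent a (suc k) = cong suc (length-ascent (suc a) k)
length-rest (down a zero) = refl
length-rest (down a (suc k)) = cong suc (length-rest (down a k))

length-tour : ∀ rs → length (tour rs) ≡ sum (map size rs)
length-tour [] = refl
length-tour (r ∷ rs) = cong suc (trans (length-++ (rest r)) (cong₂ _+_ (length-rest r) (length-tour rs)))

Between : ℕ → ℕ → ℕ → Set
Between lo hi y = lo ≤ y × y ≤ hi

ascent-between : ∀ a k → All (Between (suc a) (k + a)) (ascent a k)
ascent-between a zero = []
ascent-between a (suc k) = (≤-refl , s≤s (m≤n+m a k))
  ∷ All.map (λ (p , q) → ≤-trans (n≤1+n _) p , ≤-trans q (≤-reflexive (+-suc k a))) (ascent-between (suc a) k)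

descent-between : ∀ a k → All (λ y → a ≤ y × y < k + a) (descent a k)
descent-between a zero = []
descent-between a (suc k) = (m≤n+m a k , ≤-refl) ∷ All.map (λ (p , q) → p , m<n⇒m<1+n q) (descent-between a k)

vertices-between : ∀ r → All (Between (low r) (high r)) (vertices r)
vertices-between (up a k) = (≤-refl , m≤n+m a k) ∷ All.map (λ (p , q) → ≤-trans (n≤1+n a) p , q) (ascent-between a k)
vertices-between (down a k) = (m≤n+m a k , ≤-refl) ∷ All.map (λ (p , q) → p , <⇒≤ q) (descent-between a k)

ascent-unique : ∀ a k → Unique (a ∷ ascent a k)
ascent-unique a zero = [] ∷ []
ascent-unique a (suc k) = All.map (λ (p , _) → <⇒≢ p) (ascent-between a (suc k)) ∷ ascent-unique (suc a) k

vertices-unique : ∀ r → Unique (vertices r)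
vertices-unique (up a k) = ascent-unique a k
vertices-unique (down a zero) = [] ∷ []
vertices-unique (down a (suc k)) = All.map (λ (_ , q) → >⇒≢ q) (descent-between a (suc k)) ∷ vertices-unique (down a k)

Increasing : ℕ → ℕ → List Run → Set
Increasing n b [] = ⊤
Increasing n b (r ∷ rs) = b ≤ low r × high r ≤ n × Increasing n (suc (high r)) rs

increasing-tour : ∀ {n b} rs → Increasing n b rs → All (Between b n) (tour rs) × Unique (tour rs)
increasing-tour [] tt = [] , []
increasing-tour (r ∷ rs) (b≤ , hi≤ , inc) =
  All.++⁺ (All.map (λ (p , q) → ≤-trans b≤ p , ≤-trans q hi≤) (vertices-between r))
          (All.map (λ (p , q) → ≤-trans (≤-trans b≤ (m≤n+m (low r) (extent r))) (≤-trans (n≤1+n _) p) , q) inRange)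
  , AllPairs.++⁺ (vertices-unique r) unique
      (All.map (λ (_ , x≤) → All.map (λ (y> , _) → <⇒≢ (≤-<-trans x≤ y>)) inRange) (vertices-between r))
  where
  inRange = proj₁ (increasing-tour rs inc)
  unique = proj₂ (increasing-tour rs inc)

Fits : ℕ → Run → Set
Fits n r = 1 ≤ low r × high r ≤ n

increasing-fits : ∀ {n b} rs → 1 ≤ b → Increasing n b rs → All (Fits n) rs
increasing-fits [] _ tt = []
increasing-fits (r ∷ rs) 1≤b (b≤ , hi≤ , inc) = (≤-trans 1≤b b≤ , hi≤) ∷ increasing-fits rs (s≤s z≤n) inc

HasCycle : ℕ → List (ℕ × ℕ) → ℕ → ℕ → Set
HasCycle n S l c = ∃ λ vs → IsCycle n S vs × length vs ≡ l × chordsUsed S vs ≡ c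

module Walks (n : ℕ) {S : List (ℕ × ℕ)} (gaps : All Gap S) where

  Edge : ℕ × ℕ → Set
  Edge e = Adj n S (proj₁ e) (proj₂ e)

  Walk : ℕ → List ℕ → ℕ → Set
  Walk x ys c = All Edge (pathEdges x ys) × countB (isChordEdgeB S) (pathEdges x ys) ≡ c

  walk-chord : ∀ {x y ys c} → InS S x y → Walk y ys c → Walk x (y ∷ ys) (suc c)
  walk-chord {y = y} {ys} j (edges , count) =
    inj₂ j ∷ edges , trans (countB-yes _ (pathEdges y ys) (isChordEdgeB-complete j)) (cong suc count)

  walk-up : ∀ {x ys c} → 1 ≤ x → suc x ≤ n → Walk (suc x) ys c → Walk x (suc x ∷ ys) c
  walk-up {x} {ys} 1≤x x<n (edges , count) =
    inj₁ ((1≤x , <⇒≤ x<n) , (s≤s z≤n , x<n) , inj₁ refl) ∷ edges ,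
    trans (countB-no _ (pathEdges (suc x) ys) (consecutive-notInS gaps x ∘ isChordEdgeB-sound S x (suc x))) count

  walk-down : ∀ {x ys c} → 1 ≤ x → suc x ≤ n → Walk x ys c → Walk (suc x) (x ∷ ys) c
  walk-down {x} {ys} 1≤x x<n (edges , count) =
    inj₁ ((s≤s z≤n , x<n) , (1≤x , <⇒≤ x<n) , inj₂ (inj₁ refl)) ∷ edges ,
    trans (countB-no _ (pathEdges x ys) (consecutive-notInS gaps x ∘ InS-sym ∘ isChordEdgeB-sound S (suc x) x)) count

  ascent-walk : ∀ a k {w ws c} → 1 ≤ a → k + a ≤ n → InS S (k + a) w → Walk w ws c →
    Walk a (ascent a k ++ w ∷ ws) (suc c)
  ascent-walk a zero _ _ j walk = walk-chord j walk
  ascent-walk a (suc k) {w} 1≤a le j walk =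
    walk-up 1≤a (≤-trans (s≤s (m≤n+m a k)) le)
      (ascent-walk (suc a) k (s≤s z≤n) (subst (_≤ n) (sym (+-suc k a)) le) (subst (λ z → InS S z w) (sym (+-suc k a)) j) walk)

  descent-walk : ∀ a k {w ws c} → 1 ≤ a → k + a ≤ n → InS S a w → Walk w ws c →
    Walk (k + a) (descent a k ++ w ∷ ws) (suc c)
  descent-walk a zero _ _ j walk = walk-chord j walk
  descent-walk a (suc k) 1≤a le j walk =
    walk-down (≤-trans 1≤a (m≤n+m a k)) le (descent-walk a k 1≤a (<⇒≤ le) j walk)

  run-walk : ∀ r {w ws c} → Fits n r → InS S (end r) w → Walk w ws c → Walk (start r) (rest r ++ w ∷ ws) (suc c)
  run-walk (up a k) (1≤a , le) = ascent-walk a k 1≤a le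
  run-walk (down a k) (1≤a , le) = descent-walk a k 1≤a le

  Linked : ℕ → Run → List Run → Set
  Linked f r [] = InS S (end r) f
  Linked f r (r′ ∷ rs) = InS S (end r) (start r′) × Linked f r′ rs

  runs-walk : ∀ f r rs → All (Fits n) (r ∷ rs) → Linked f r rs →
    Walk (start r) (rest r ++ catRuns rs [ f ]) (length (r ∷ rs))
  runs-walk f r [] (fit ∷ []) j = run-walk r fit j ([] , refl)
  runs-walk f r (r′ ∷ rs) (fit ∷ fits) (j , js) = run-walk r fit j (runs-walk f r′ rs fits js)

  runs-cycle : ∀ r rs → Increasing n 1 (r ∷ rs) → Linked (start r) r rs → 3 ≤ sum (map size (r ∷ rs)) →
    HasCycle n S (sum (map size (r ∷ rs))) (length (r ∷ rs))
  runs-cycle r rs inc links 3≤ =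
    tour (r ∷ rs) ,
    (subst (3 ≤_) (sym (length-tour (r ∷ rs))) 3≤ , proj₂ inRange-unique , proj₁ inRange-unique ,
      subst (All Edge) (sym (cycEdges-tour r rs)) (proj₁ walk)) ,
    length-tour (r ∷ rs) ,
    trans (cong (countB (isChordEdgeB S)) (cycEdges-tour r rs)) (proj₂ walk)
    where
    inRange-unique = increasing-tour (r ∷ rs) inc
    walk = runs-walk (start r) r rs (increasing-fits (r ∷ rs) ≤-refl inc) links

_≟²_ : (x y : ℕ × ℕ) → Dec (x ≡ y)
_≟²_ = ≡-dec _≟_ _≟_

inV? : ∀ n v → Dec (InV n v)
inV? n v = (1 ≤? v) ×-dec (v ≤? n)

cycleAdj? : ∀ n u v → Dec (CycleAdj n u v)
cycleAdj? n u v = inV? n u ×-dec inV? n v ×-dec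
  ((v ≟ suc u) ⊎-dec (u ≟ suc v) ⊎-dec ((u ≟ n) ×-dec (v ≟ 1)) ⊎-dec ((u ≟ 1) ×-dec (v ≟ n)))

isChord? : ∀ n e → Dec (IsChord n e)
isChord? n (a , b) = inV? n a ×-dec inV? n b ×-dec (a <? b) ×-dec ¬? (cycleAdj? n a b)

chordsOf : ℕ → List (ℕ × ℕ) → List (ℕ × ℕ)
chordsOf n ps = deduplicate _≟²_ (filter (isChord? n) ps)

chordsOf-chordSet : ∀ n ps → ChordSet n (chordsOf n ps)
chordsOf-chordSet n ps =
  Unique.deduplicate-! _≟²_ (filter (isChord? n) ps) ,
  All.deduplicate⁺ _≟²_ (All.all-filter (isChord? n) ps)

length-chordsOf : ∀ n ps → length (chordsOf n ps) ≤ length ps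
length-chordsOf n ps = ≤-trans (length-deduplicate _≟²_ (filter (isChord? n) ps)) (length-filter (isChord? n) ps)

∈-chordsOf : ∀ {n ps e} → e ∈ ps → IsChord n e → e ∈ chordsOf n ps
∈-chordsOf {n} e∈ps chord =
  Any.deduplicate⁺ _≟²_ (λ y≡z x≡y → trans x≡y (sym y≡z)) (∈-filter⁺ (isChord? n) e∈ps chord)

isChord⇒gap : ∀ n e → IsChord n e → Gap e
isChord⇒gap n (a , b) (inVa , inVb , a<b , ¬adj) with m≤n⇒m<n∨m≡n a<b
... | inj₁ gap = gap
... | inj₂ b≡1+a = ⊥-elim (¬adj (inVa , inVb , inj₁ (sym b≡1+a)))

chordsOf-gaps : ∀ n ps → All Gap (chordsOf n ps)
chordsOf-gaps n ps = All.map (isChord⇒gap n _) (proj₂ (chordsOf-chordSet n ps))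

-- The wrap-around edge {1, n} is excluded by asking for b < n or 2 ≤ a.
isChord-intro : ∀ {n a b} → 1 ≤ a → suc a < b → b ≤ n → b < n ⊎ 2 ≤ a → IsChord n (a , b)
isChord-intro {n} {a} {b} 1≤a gap b≤n side =
  (1≤a , ≤-trans a≤b b≤n) , (≤-trans 1≤a a≤b , b≤n) , <-trans (n<1+n a) gap , ¬adj
  where
  a≤b : a ≤ b
  a≤b = ≤-trans (n≤1+n a) (<⇒≤ gap)
  ¬adj : ¬ CycleAdj n a b
  ¬adj (_ , _ , inj₁ refl) = <-irrefl refl gap
  ¬adj (_ , _ , inj₂ (inj₁ refl)) = <⇒≱ gap (m≤n+m b 2)
  ¬adj (_ , _ , inj₂ (inj₂ (inj₁ (_ , refl)))) = <⇒≱ gap (s≤s z≤n)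
  ¬adj (_ , _ , inj₂ (inj₂ (inj₂ (refl , refl)))) = Sum.[ <-irrefl refl , <⇒≱ (s≤s (s≤s z≤n)) ] side

fromDigits : ℕ → ℕ → List ℕ → ℕ
fromDigits m j [] = 0
fromDigits m j (c ∷ cs) = c * m ^ j + fromDigits m (suc j) cs

fromDigits-suc : ∀ m j cs → fromDigits m (suc j) cs ≡ m * fromDigits m j cs
fromDigits-suc m j [] = sym (*-zeroʳ m)
fromDigits-suc m j (c ∷ cs) = begin
  c * (m * m ^ j) + fromDigits m (suc (suc j)) cs ≡⟨ cong (c * (m * m ^ j) +_) (fromDigits-suc m (suc j) cs) ⟩
  c * (m * m ^ j) + m * fromDigits m (suc j) cs   ≡⟨ rearrange c m (m ^ j) (fromDigits m (suc j) cs) ⟩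
  m * (c * m ^ j + fromDigits m (suc j) cs)       ∎
  where
  open ≡-Reasoning
  rearrange : ∀ c m x y → c * (m * x) + m * y ≡ m * (c * x + y)
  rearrange = solve-∀

digits : ∀ m .{{_ : NonZero m}} t r → r < m ^ t →
  ∃ λ cs → length cs ≡ t × All (_< m) cs × fromDigits m 0 cs ≡ r
digits m zero zero _ = [] , refl , [] , refl
digits m zero (suc r) (s≤s ())
digits m (suc t) r r<m^[1+t]
  with digits m t (r / m) (m<n*o⇒m/o<n (subst (r <_) (*-comm m (m ^ t)) r<m^[1+t]))
... | cs , refl , cs<m , value = r % m ∷ cs , refl , m%n<n r m ∷ cs<m , (begin
  r % m * 1 + fromDigits m 1 cs ≡⟨ cong₂ _+_ (*-identityʳ (r % m)) (fromDigits-suc m 0 cs) ⟩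
  r % m + m * fromDigits m 0 cs ≡⟨ cong (λ v → r % m + m * v) value ⟩
  r % m + m * (r / m)           ≡⟨ cong (r % m +_) (*-comm m (r / m)) ⟩
  r % m + r / m * m             ≡⟨ m≡m%n+[m/n]*n r m ⟨
  r                             ∎)
  where open ≡-Reasoning

j<m^j : ∀ {m} → 2 ≤ m → ∀ j → j < m ^ j
j<m^j 2≤m zero = s≤s z≤n
j<m^j {m} 2≤m (suc j) = begin-strict
  suc j         <⟨ m≤m+n (suc (suc j)) j ⟩
  suc (suc j) + j ≡⟨ double j ⟩
  2 * suc j     ≤⟨ *-mono-≤ 2≤m (j<m^j 2≤m j) ⟩
  m * m ^ j     ∎
  where
  open ≤-Reasoning
  double : ∀ i → suc (suc i) + i ≡ 2 * suc i
  double = solve-∀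

2*j≤m^j : ∀ {m j} → 2 ≤ m → 1 ≤ j → 2 * j ≤ m ^ j
2*j≤m^j {j = suc i} 2≤m _ = *-mono-≤ 2≤m (j<m^j 2≤m i)

[1+a]^j*[a∸j]≤a^[1+j] : ∀ a j → j ≤ a → suc a ^ j * (a ∸ j) ≤ a ^ suc j
[1+a]^j*[a∸j]≤a^[1+j] a zero _ = ≤-reflexive (trans (+-identityʳ a) (sym (*-identityʳ a)))
[1+a]^j*[a∸j]≤a^[1+j] a (suc i) i<a = begin
  suc a * suc a ^ i * b       ≡⟨ rearrange (suc a) (suc a ^ i) b ⟩
  suc a ^ i * (suc a * b)     ≤⟨ *-monoʳ-≤ (suc a ^ i) (≤-trans (+-monoˡ-≤ (a * b) b≤a) (≤-reflexive (sym (*-suc a b)))) ⟩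
  suc a ^ i * (a * suc b)     ≡⟨ rearrange′ (suc a ^ i) a (suc b) ⟩
  a * (suc a ^ i * suc b)     ≡⟨ cong (λ x → a * (suc a ^ i * x)) (+-∸-assoc 1 i<a) ⟨
  a * (suc a ^ i * (a ∸ i))   ≤⟨ *-monoʳ-≤ a ([1+a]^j*[a∸j]≤a^[1+j] a i (<⇒≤ i<a)) ⟩
  a * a ^ suc i               ∎
  where
  open ≤-Reasoning
  b = a ∸ suc i
  b≤a : b ≤ a
  b≤a = m∸n≤m a (suc i)
  rearrange : ∀ x y z → x * y * z ≡ y * (x * z)
  rearrange = solve-∀
  rearrange′ : ∀ x y z → x * (y * z) ≡ y * (x * z)
  rearrange′ = solve-∀

isCeilRoot⇒≥ : ∀ {n k m b} .{{_ : NonZero k}} → IsCeilRoot n k m → b ^ k ≤ n → b ≤ m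
isCeilRoot⇒≥ {k = k} (n≤m^k , _) b^k≤n = ≮⇒≥ (λ m<b → <⇒≱ (^-monoˡ-< k m<b) (≤-trans b^k≤n n≤m^k))

isCeilRoot⇒[m∸1]^k<n : ∀ {n k m} → 1 ≤ m → IsCeilRoot n k m → (m ∸ 1) ^ k < n
isCeilRoot⇒[m∸1]^k<n {m = suc a} _ (_ , least) = ≰⇒> (1+n≰n ∘ least a)

anchor : ℕ → ℕ → ℕ
anchor m j = m ^ j + 2 * j

anchor-mono : ∀ m .{{_ : NonZero m}} {i j} → i ≤ j → anchor m i ≤ anchor m j
anchor-mono m i≤j = +-mono-≤ (^-monoʳ-≤ m i≤j) (*-monoʳ-≤ 2 i≤j)

anchor-gap : ∀ m j {c} → c < m → 2 + (c * m ^ j + anchor m j) ≤ anchor m (suc j)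
anchor-gap m j {c} c<m = begin
  2 + (c * m ^ j + (m ^ j + 2 * j)) ≡⟨ rearrange c (m ^ j) j ⟩
  suc c * m ^ j + 2 * suc j          ≤⟨ +-monoˡ-≤ (2 * suc j) (*-monoˡ-≤ (m ^ j) c<m) ⟩
  m * m ^ j + 2 * suc j              ∎
  where
  open ≤-Reasoning
  rearrange : ∀ c x j → 2 + (c * x + (x + 2 * j)) ≡ suc c * x + 2 * suc j
  rearrange = solve-∀

anchor≤[m∸1]^[1+q] : ∀ {m q} → 1 ≤ q → suc q + 2 ≤ m → anchor m q ≤ (m ∸ 1) ^ suc q
anchor≤[m∸1]^[1+q] {suc a} {q} 1≤q (s≤s q+2≤a) = begin
  suc a ^ q + 2 * q         ≤⟨ +-monoʳ-≤ (suc a ^ q) (2*j≤m^j 2≤1+a 1≤q) ⟩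
  suc a ^ q + suc a ^ q     ≡⟨ twice (suc a ^ q) ⟩
  suc a ^ q * 2             ≤⟨ *-monoʳ-≤ (suc a ^ q) (m+n≤o⇒m≤o∸n 2 (subst (_≤ a) (+-comm q 2) q+2≤a)) ⟩
  suc a ^ q * (a ∸ q)       ≤⟨ [1+a]^j*[a∸j]≤a^[1+j] a q (≤-trans (m≤m+n q 2) q+2≤a) ⟩
  a ^ suc q                 ∎
  where
  open ≤-Reasoning
  2≤1+a : 2 ≤ suc a
  2≤1+a = ≤-trans (m≤n+m 2 q) (≤-trans q+2≤a (n≤1+n a))
  twice : ∀ x → x + x ≡ x * 2
  twice = solve-∀

length-cartesianProductWith : ∀ {A B C : Set} (f : A → B → C) xs ys →
  length (cartesianProductWith f xs ys) ≡ length xs * length ys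
length-cartesianProductWith f [] ys = refl
length-cartesianProductWith f (x ∷ xs) ys =
  trans (length-++ (map (f x) ys)) (cong₂ _+_ (length-map (f x) ys) (length-cartesianProductWith f xs ys))

module Construction (q m n : ℕ) (1≤q : 1 ≤ q) (k+2≤m : suc q + 2 ≤ m)
                    (anchor<n : anchor m q < n) (n≤m^k : n ≤ m ^ suc q) where

  1≤m : 1 ≤ m
  1≤m = ≤-trans (s≤s z≤n) k+2≤m

  P : ℕ
  P = m ^ q

  instance
    m-nonZero : NonZero m
    m-nonZero = >-nonZero 1≤m
    P-nonZero : NonZero P
    P-nonZero = m^n≢0 m q

  maxOffset : ℕ
  maxOffset = n ∸ suc (anchor m q)

  maxOffset+1+anchor≡n : maxOffset + suc (anchor m q) ≡ n
  maxOffset+1+anchor≡n = m∸n+n≡m anchor<n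

  e+anchor<n : ∀ {e} → e ≤ maxOffset → e + anchor m q < n
  e+anchor<n {e} e≤max = ≤-trans (s≤s (+-monoˡ-≤ (anchor m q) e≤max))
    (≤-reflexive (trans (sym (+-suc maxOffset _)) maxOffset+1+anchor≡n))

  3≤anchor : 3 ≤ anchor m q
  3≤anchor = +-mono-≤ (m^n>0 m q) (*-monoʳ-≤ 2 1≤q)

  4+3q≤n : 4 + 3 * q ≤ n
  4+3q≤n = begin
    4 + 3 * q             ≡⟨ rearrange q ⟩
    suc (suc q + 2 + 2 * q) ≤⟨ s≤s (+-monoˡ-≤ (2 * q) (≤-trans k+2≤m m≤m^q)) ⟩
    suc (anchor m q)      ≤⟨ anchor<n ⟩
    n                     ∎
    where
    open ≤-Reasoning
    rearrange : ∀ q → 4 + 3 * q ≡ suc (suc q + 2 + 2 * q)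
    rearrange = solve-∀
    m≤m^q : m ≤ m ^ q
    m≤m^q = ≤-trans (≤-reflexive (sym (*-identityʳ m))) (^-monoʳ-≤ m 1≤q)

  1+[q∸1]≡q : suc (q ∸ 1) ≡ q
  1+[q∸1]≡q = m+[n∸m]≡n 1≤q

  levelChord : ℕ → ℕ → ℕ × ℕ
  levelChord j c = c * m ^ j + anchor m j , anchor m (suc j)

  topChord : ℕ → ℕ × ℕ
  topChord e = 1 , e + anchor m q

  wrapChord : ℕ → ℕ × ℕ
  wrapChord D = 1 , D + suc (2 * q)

  rungs : ℕ → ℕ → ℕ → List (ℕ × ℕ)
  rungs x a zero = [ (x , n) ]
  rungs x a (suc r) = (x , suc a) ∷ rungs a (2 + a) r

  levelChords topChords : List (ℕ × ℕ)
  levelChords = cartesianProductWith levelChord (upTo q) (upTo m)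
  topChords = applyUpTo (λ c → topChord (c * P)) (m ∸ 1)

  candidates : List (ℕ × ℕ)
  candidates = levelChords ++ topChords ++ topChord maxOffset ∷ applyUpTo wrapChord (suc q) ++ rungs 2 3 (q ∸ 1)

  chords : List (ℕ × ℕ)
  chords = chordsOf n candidates

  open Walks n (chordsOf-gaps n candidates)

  level-chord : ∀ {j c} → j < q → c < m → InS chords (c * m ^ j + anchor m j) (anchor m (suc j))
  level-chord {j} {c} j<q c<m = inj₁ (∈-chordsOf
    (∈-++⁺ˡ (∈-cartesianProductWith⁺ levelChord (∈-upTo⁺ j<q) (∈-upTo⁺ c<m)))
    (isChord-intro 1≤ (anchor-gap m j c<m) (<⇒≤ anchor<n′) (inj₁ anchor<n′)))
    where
    1≤ : 1 ≤ c * m ^ j + anchor m j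
    1≤ = ≤-trans (m^n>0 m j) (≤-trans (m≤m+n (m ^ j) (2 * j)) (m≤n+m (anchor m j) (c * m ^ j)))
    anchor<n′ : anchor m (suc j) < n
    anchor<n′ = ≤-<-trans (anchor-mono m j<q) anchor<n

  data TopOffset : ℕ → Set where
    stride : ∀ {c} → c < m ∸ 1 → c * P ≤ maxOffset → TopOffset (c * P)
    final : TopOffset maxOffset

  topOffset≤max : ∀ {e} → TopOffset e → e ≤ maxOffset
  topOffset≤max (stride _ le) = le
  topOffset≤max final = ≤-refl

  top-chord : ∀ {e} → TopOffset e → InS chords (e + anchor m q) 1
  top-chord {e} offset = inj₂ (∈-chordsOf (member offset)
    (isChord-intro ≤-refl (≤-trans 3≤anchor (m≤n+m _ e)) (<⇒≤ e+anchor<n′) (inj₁ e+anchor<n′)))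
    where
    e+anchor<n′ : e + anchor m q < n
    e+anchor<n′ = e+anchor<n (topOffset≤max offset)
    member : ∀ {e} → TopOffset e → topChord e ∈ candidates
    member (stride c< _) = ∈-++⁺ʳ levelChords (∈-++⁺ˡ (∈-applyUpTo⁺ (λ c → topChord (c * P)) c<))
    member final = ∈-++⁺ʳ levelChords (∈-++⁺ʳ topChords (here refl))

  levelRuns : ℕ → List ℕ → ℕ → List Run
  levelRuns j [] e = [ up (anchor m j) e ]
  levelRuns j (c ∷ cs) e = up (anchor m j) (c * m ^ j) ∷ levelRuns (suc j) cs e

  levelRuns-increasing : ∀ j cs {e b} → b ≤ anchor m j → All (_< m) cs → j + length cs ≡ q → e ≤ maxOffset →
    Increasing n b (levelRuns j cs e)
  levelRuns-increasing j [] {e} b≤ [] j+0≡q e≤max =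
    b≤ , <⇒≤ (subst (λ i → e + anchor m i < n) (trans (sym j+0≡q) (+-identityʳ j)) (e+anchor<n e≤max)) , tt
  levelRuns-increasing j (c ∷ cs) b≤ (c<m ∷ cs<m) j+1+l≡q e≤max =
    b≤ , high≤n ,
    levelRuns-increasing (suc j) cs (≤-trans (n≤1+n _) (anchor-gap m j c<m)) cs<m (trans (sym (+-suc j (length cs))) j+1+l≡q) e≤max
    where
    1+j≤q : suc j ≤ q
    1+j≤q = ≤-trans (≤-trans (m≤m+n (suc j) (length cs)) (≤-reflexive (sym (+-suc j (length cs))))) (≤-reflexive j+1+l≡q)
    high≤n : c * m ^ j + anchor m j ≤ n
    high≤n = ≤-trans (≤-trans (m≤n+m _ 2) (anchor-gap m j c<m)) (≤-trans (anchor-mono m 1+j≤q) (<⇒≤ anchor<n))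

  levelRuns-linked : ∀ j c cs {e} → c < m → All (_< m) cs → suc j + length cs ≡ q → TopOffset e →
    Linked 1 (up (anchor m j) (c * m ^ j)) (levelRuns (suc j) cs e)
  levelRuns-linked j c [] {e} c<m [] 1+j+0≡q offset =
    level-chord (≤-trans (≤-reflexive (sym (+-identityʳ (suc j)))) (≤-reflexive 1+j+0≡q)) c<m ,
    subst (λ i → InS chords (e + anchor m i) 1) (trans (sym 1+j+0≡q) (+-identityʳ (suc j))) (top-chord offset)
  levelRuns-linked j c (c′ ∷ cs) c<m (c′<m ∷ cs<m) 1+j+l≡q offset =
    level-chord (≤-trans (m≤m+n (suc j) (length (c′ ∷ cs))) (≤-reflexive 1+j+l≡q)) c<m ,
    levelRuns-linked (suc j) c′ cs c′<m cs<m (trans (sym (+-suc (suc j) (length cs))) 1+j+l≡q) offset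

  levelRuns-size : ∀ j cs e → sum (map size (levelRuns j cs e)) ≡ length cs + fromDigits m j cs + suc e
  levelRuns-size j [] e = +-identityʳ (suc e)
  levelRuns-size j (c ∷ cs) e =
    trans (cong (suc (c * m ^ j) +_) (levelRuns-size (suc j) cs e)) (rearrange (c * m ^ j) (length cs) (fromDigits m (suc j) cs) e)
    where
    rearrange : ∀ x l v e → suc x + (l + v + suc e) ≡ suc l + (x + v) + suc e
    rearrange = solve-∀

  levelRuns-length : ∀ j cs e → length (levelRuns j cs e) ≡ suc (length cs)
  levelRuns-length j [] e = refl
  levelRuns-length j (c ∷ cs) e = cong suc (levelRuns-length (suc j) cs e)

  maxOffset<[m∸1]*P : maxOffset < (m ∸ 1) * P
  maxOffset<[m∸1]*P = +-cancelʳ-< P maxOffset ((m ∸ 1) * P) (begin-strict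
    maxOffset + P          ≤⟨ +-monoʳ-≤ maxOffset (m≤m+n P (2 * q)) ⟩
    maxOffset + anchor m q <⟨ e+anchor<n ≤-refl ⟩
    n                      ≤⟨ n≤m^k ⟩
    m * P                  ≡⟨ cong (_* P) (m∸n+n≡m 1≤m) ⟨
    (m ∸ 1 + 1) * P        ≡⟨ distrib (m ∸ 1) P ⟩
    (m ∸ 1) * P + P        ∎)
    where
    open ≤-Reasoning
    distrib : ∀ x p → (x + 1) * p ≡ x * p + p
    distrib = solve-∀

  -- u = l - k is split as r + e: r is spread over the levels by its base-m digits, e is climbed at the top.
  top-split : ∀ u → u + 2 * suc q ≤ n → ∃ λ e → TopOffset e × ∃ λ r → r < P × r + e ≡ u
  top-split u u+2k≤n with u ≤? maxOffset
  ... | yes u≤max =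
    u / P * P , stride u/P<m∸1 (≤-trans (m/n*n≤m u P) u≤max) , u % P , m%n<n u P , sym (m≡m%n+[m/n]*n u P)
    where
    u/P<m∸1 : u / P < m ∸ 1
    u/P<m∸1 = *-cancelʳ-< P (u / P) (m ∸ 1) (≤-<-trans (≤-trans (m/n*n≤m u P) u≤max) maxOffset<[m∸1]*P)
  ... | no u≰max = maxOffset , final , u ∸ maxOffset , r<P , m∸n+n≡m max≤u
    where
    open ≤-Reasoning
    max≤u : maxOffset ≤ u
    max≤u = <⇒≤ (≰⇒> u≰max)
    rearrangeˡ : ∀ u q → suc u + suc (2 * q) ≡ u + 2 * suc q
    rearrangeˡ = solve-∀
    rearrangeʳ : ∀ t p q → t + suc (p + 2 * q) ≡ t + p + suc (2 * q)
    rearrangeʳ = solve-∀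
    u<max+P : u < maxOffset + P
    u<max+P = +-cancelʳ-≤ (suc (2 * q)) (suc u) (maxOffset + P) (begin
      suc u + suc (2 * q)            ≡⟨ rearrangeˡ u q ⟩
      u + 2 * suc q                  ≤⟨ u+2k≤n ⟩
      n                              ≡⟨ maxOffset+1+anchor≡n ⟨
      maxOffset + suc (P + 2 * q)    ≡⟨ rearrangeʳ maxOffset P q ⟩
      maxOffset + P + suc (2 * q)    ∎)
    r<P : u ∸ maxOffset < P
    r<P = +-cancelʳ-< maxOffset (u ∸ maxOffset) P (subst₂ _<_ (sym (m∸n+n≡m max≤u)) (+-comm maxOffset P) u<max+P)

  short-cycle : ∀ l → suc q ≤ l → 3 ≤ l → l + suc q ≤ n → HasCycle n chords l (suc q)
  short-cycle l k≤l 3≤l l+k≤n with top-split (l ∸ suc q) u+2k≤n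
    where
    u+2k≤n : l ∸ suc q + 2 * suc q ≤ n
    u+2k≤n = ≤-trans (≤-reflexive (trans (rearrange (l ∸ suc q) (suc q)) (cong (_+ suc q) (m∸n+n≡m k≤l)))) l+k≤n
      where
      rearrange : ∀ u k → u + 2 * k ≡ u + k + k
      rearrange = solve-∀
  ... | e , offset , r , r<P , r+e≡u with digits m q r r<P
  ... | [] , 0≡q , _ = ⊥-elim (<⇒≢ 1≤q 0≡q)
  ... | c ∷ cs , l≡q , c<m ∷ cs<m , value =
    subst₂ (HasCycle n chords) size≡l (trans (levelRuns-length 0 (c ∷ cs) e) (cong suc l≡q))
      (runs-cycle (up (anchor m 0) (c * m ^ 0)) (levelRuns 1 cs e)
        (levelRuns-increasing 0 (c ∷ cs) ≤-refl (c<m ∷ cs<m) l≡q (topOffset≤max offset))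
        (levelRuns-linked 0 c cs c<m cs<m l≡q offset)
        (subst (3 ≤_) (sym size≡l) 3≤l))
    where
    open ≡-Reasoning
    size≡l : sum (map size (levelRuns 0 (c ∷ cs) e)) ≡ l
    size≡l = begin
      sum (map size (levelRuns 0 (c ∷ cs) e))               ≡⟨ levelRuns-size 0 (c ∷ cs) e ⟩
      length (c ∷ cs) + fromDigits m 0 (c ∷ cs) + suc e    ≡⟨ cong₂ (λ i v → i + v + suc e) l≡q value ⟩
      q + r + suc e                                        ≡⟨ rearrange q r e ⟩
      suc q + (r + e)                                      ≡⟨ cong (suc q +_) r+e≡u ⟩
      suc q + (l ∸ suc q)                                  ≡⟨ m+[n∸m]≡n k≤l ⟩
      l                                                    ∎
      where
      rearrange : ∀ q r e → q + r + suc e ≡ suc q + (r + e)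
      rearrange = solve-∀

  module Ladder (D E : ℕ) (D<k : D < suc q) (1≤E : 1 ≤ E) (E+σ≡n : E + (D + suc (2 * q)) ≡ n) where

    σ : ℕ
    σ = D + suc (2 * q)

    σ<n : σ < n
    σ<n = subst (σ <_) E+σ≡n (+-monoˡ-≤ σ 1≤E)

    3≤σ : 3 ≤ σ
    3≤σ = ≤-trans (s≤s (*-monoʳ-≤ 2 1≤q)) (m≤n+m _ D)

    ladder : ℕ → ℕ → List Run
    ladder a zero = [ down σ E ]
    ladder a (suc r) = down a 1 ∷ ladder (2 + a) r

    next-rung : ∀ a r → 2 + a + 2 * r ≡ a + 2 * suc r
    next-rung = solve-∀

    1+a≤n : ∀ {a r} → a + 2 * suc r ≤ σ → suc a ≤ n
    1+a≤n {a} {r} le = ≤-trans (≤-trans (≤-trans (≤-reflexive (+-comm 1 a)) (+-monoʳ-≤ a (s≤s z≤n))) le) (<⇒≤ σ<n)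

    ladder-increasing : ∀ a r {b} → b ≤ a → a + 2 * r ≤ σ → Increasing n b (ladder a r)
    ladder-increasing a zero b≤a a+0≤σ = ≤-trans b≤a (≤-trans (m≤m+n a 0) a+0≤σ) , ≤-reflexive E+σ≡n , tt
    ladder-increasing a (suc r) b≤a le =
      b≤a , 1+a≤n le , ladder-increasing (2 + a) r ≤-refl (≤-trans (≤-reflexive (next-rung a r)) le)

    wrap-chord : InS chords σ 1
    wrap-chord = inj₂ (∈-chordsOf
      (∈-++⁺ʳ levelChords (∈-++⁺ʳ topChords (there (∈-++⁺ˡ (∈-applyUpTo⁺ wrapChord D<k)))))
      (isChord-intro ≤-refl 3≤σ (<⇒≤ σ<n) (inj₁ σ<n)))

    ladder-linked : ∀ R a r → 2 ≤ end R → 2 + end R ≤ suc a → a + 2 * r ≤ σ →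
      (∀ {e} → e ∈ rungs (end R) a r → e ∈ candidates) → Linked 1 R (ladder a r)
    ladder-linked R a zero 2≤x 2+x≤1+a a+0≤σ rungs⊆ =
      subst (InS chords (end R)) (sym E+σ≡n) (inj₁ (∈-chordsOf (rungs⊆ (here refl))
        (isChord-intro (≤-trans (s≤s z≤n) 2≤x) 2+x≤n ≤-refl (inj₂ 2≤x))))
      , wrap-chord
      where
      2+x≤n : 2 + end R ≤ n
      2+x≤n = ≤-trans 2+x≤1+a (≤-trans (s≤s (≤-trans (m≤m+n a 0) a+0≤σ)) σ<n)
    ladder-linked R a (suc r) 2≤x 2+x≤1+a le rungs⊆ =
      inj₁ (∈-chordsOf (rungs⊆ (here refl)) (isChord-intro (≤-trans (s≤s z≤n) 2≤x) 2+x≤1+a (1+a≤n le) (inj₂ 2≤x)))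
      , ladder-linked (down a 1) (2 + a) r (≤-trans 2≤x (≤-trans (n≤1+n _) (≤-pred 2+x≤1+a))) (n≤1+n _)
          (≤-trans (≤-reflexive (next-rung a r)) le) (rungs⊆ ∘ there)

    ladder-size : ∀ a r → sum (map size (ladder a r)) ≡ 2 * r + suc E
    ladder-size a zero = +-identityʳ (suc E)
    ladder-size a (suc r) = trans (cong (2 +_) (ladder-size (2 + a) r)) (rearrange r E)
      where
      rearrange : ∀ r E → 2 + (2 * r + suc E) ≡ 2 * suc r + suc E
      rearrange = solve-∀

    ladder-length : ∀ a r → length (ladder a r) ≡ suc r
    ladder-length a zero = refl
    ladder-length a (suc r) = cong suc (ladder-length (2 + a) r)

    ladder-cycle : HasCycle n chords (suc (2 * q) + E) (suc q)
    ladder-cycle = subst₂ (HasCycle n chords) size≡ (cong suc (trans (ladder-length 3 (q ∸ 1)) 1+[q∸1]≡q))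
      (runs-cycle (up 1 1) (ladder 3 (q ∸ 1))
        (≤-refl , ≤-trans (s≤s (s≤s z≤n)) (<⇒≤ (≤-<-trans 3≤σ σ<n)) , ladder-increasing 3 (q ∸ 1) ≤-refl 3+2r≤σ)
        (ladder-linked (up 1 1) 3 (q ∸ 1) ≤-refl ≤-refl 3+2r≤σ (∈-++⁺ʳ levelChords ∘ ∈-++⁺ʳ topChords ∘ there ∘ ∈-++⁺ʳ _))
        (subst (3 ≤_) (sym size≡) (≤-trans (s≤s (*-monoʳ-≤ 2 1≤q)) (m≤m+n _ E))))
      where
      rearrangeˡ : ∀ r → 3 + 2 * r ≡ suc (2 * suc r)
      rearrangeˡ = solve-∀
      3+2r≤σ : 3 + 2 * (q ∸ 1) ≤ σ
      3+2r≤σ = ≤-trans (≤-reflexive (trans (rearrangeˡ (q ∸ 1)) (cong (λ i → suc (2 * i)) 1+[q∸1]≡q))) (m≤n+m _ D)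
      rearrangeʳ : ∀ r E → 2 + (2 * r + suc E) ≡ suc (2 * suc r) + E
      rearrangeʳ = solve-∀
      size≡ : 2 + sum (map size (ladder 3 (q ∸ 1))) ≡ suc (2 * q) + E
      size≡ = trans (cong (2 +_) (ladder-size 3 (q ∸ 1)))
        (trans (rearrangeʳ (q ∸ 1) E) (cong (λ i → suc (2 * i) + E) 1+[q∸1]≡q))

  long-cycle : ∀ l → l ≤ n → n < l + suc q → HasCycle n chords l (suc q)
  long-cycle l l≤n n<l+k = subst (λ l′ → HasCycle n chords l′ (suc q)) 1+2q+E≡l
    (Ladder.ladder-cycle (n ∸ l) (l ∸ suc (2 * q)) D<k 1≤E E+σ≡n)
    where
    open ≡-Reasoning
    D<k : n ∸ l < suc q
    D<k = +-cancelʳ-< l (n ∸ l) (suc q) (subst₂ _<_ (sym (m∸n+n≡m l≤n)) (+-comm l (suc q)) n<l+k)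
    rearrange : ∀ q → 4 + 3 * q ≡ 4 + 2 * q + q
    rearrange = solve-∀
    4+2q≤l : 4 + 2 * q ≤ l
    4+2q≤l = +-cancelʳ-≤ q (4 + 2 * q) l
      (≤-trans (≤-reflexive (sym (rearrange q))) (≤-trans 4+3q≤n (≤-pred (subst (n <_) (+-suc l q) n<l+k))))
    1≤E : 1 ≤ l ∸ suc (2 * q)
    1≤E = m+n≤o⇒m≤o∸n 1 {suc (2 * q)} (≤-trans (m≤n+m (2 + 2 * q) 2) 4+2q≤l)
    1+2q+E≡l : suc (2 * q) + (l ∸ suc (2 * q)) ≡ l
    1+2q+E≡l = m+[n∸m]≡n (≤-trans (m≤n+m _ 3) 4+2q≤l)
    swap : ∀ a b c → a + (b + c) ≡ b + (c + a)
    swap = solve-∀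
    E+σ≡n : l ∸ suc (2 * q) + (n ∸ l + suc (2 * q)) ≡ n
    E+σ≡n = begin
      l ∸ suc (2 * q) + (n ∸ l + suc (2 * q)) ≡⟨ swap (l ∸ suc (2 * q)) (n ∸ l) (suc (2 * q)) ⟩
      n ∸ l + (suc (2 * q) + (l ∸ suc (2 * q))) ≡⟨ cong (n ∸ l +_) 1+2q+E≡l ⟩
      n ∸ l + l                               ≡⟨ m∸n+n≡m l≤n ⟩
      n                                       ∎

  good : Good n (suc q) chords
  good l k≤l 3≤l l≤n with l + suc q ≤? n
  ... | yes l+k≤n = short-cycle l k≤l 3≤l l+k≤n
  ... | no l+k≰n = long-cycle l l≤n (≰⇒> l+k≰n)

  length-rungs : ∀ x a r → length (rungs x a r) ≡ suc r
  length-rungs x a zero = refl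
  length-rungs x a (suc r) = cong suc (length-rungs a (2 + a) r)

  length-candidates : length candidates ≤ suc q * m + suc q ^ 2
  length-candidates = begin
    length candidates                                   ≡⟨ count ⟩
    q * m + (m ∸ 1 + suc (suc q + suc (q ∸ 1)))         ≡⟨ regroup q m (m ∸ 1) (q ∸ 1) ⟩
    q * m + ((m ∸ 1 + 1) + (suc q + suc (q ∸ 1)))       ≡⟨ cong₂ (λ x y → q * m + (x + (suc q + y))) (m∸n+n≡m 1≤m) 1+[q∸1]≡q ⟩
    q * m + (m + (suc q + q))                           ≤⟨ m≤m+n _ (q * q) ⟩
    q * m + (m + (suc q + q)) + q * q                   ≡⟨ square q m ⟩
    suc q * m + suc q ^ 2                               ∎
    where
    open ≤-Reasoning
    count : length candidates ≡ q * m + (m ∸ 1 + suc (suc q + suc (q ∸ 1)))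
    count = trans (length-++ levelChords) (cong₂ _+_
      (trans (length-cartesianProductWith levelChord (upTo q) (upTo m)) (cong₂ _*_ (length-upTo q) (length-upTo m)))
      (trans (length-++ topChords) (cong₂ _+_ (length-applyUpTo _ (m ∸ 1))
        (cong suc (trans (length-++ (applyUpTo wrapChord (suc q)))
          (cong₂ _+_ (length-applyUpTo wrapChord (suc q)) (length-rungs 2 3 (q ∸ 1))))))))
    regroup : ∀ q m x y → q * m + (x + suc (suc q + suc y)) ≡ q * m + ((x + 1) + (suc q + suc y))
    regroup = solve-∀
    square : ∀ q m → q * m + (m + (suc q + q)) + q * q ≡ suc q * m + suc q * (suc q * 1)
    square = solve-∀

  admissible : cLe n (suc q) (suc q * m + suc q ^ 2)
  admissible = chords , chordsOf-chordSet n candidates , good , ≤-trans (length-chordsOf n candidates) length-candidates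

theorem2 : (k n m : ℕ) → 2 ≤ k → (k + 2) ^ k ≤ n → IsCeilRoot n k m →
  cLe n k (k * m + k ^ 2)
theorem2 (suc q) n m (s≤s 1≤q) [k+2]^k≤n root = Construction.admissible q m n 1≤q k+2≤m anchor<n (proj₁ root)
  where
  k+2≤m : suc q + 2 ≤ m
  k+2≤m = isCeilRoot⇒≥ {k = suc q} root [k+2]^k≤n
  anchor<n : anchor m q < n
  anchor<n = ≤-<-trans (anchor≤[m∸1]^[1+q] 1≤q k+2≤m)
    (isCeilRoot⇒[m∸1]^k<n {k = suc q} (≤-trans (s≤s z≤n) k+2≤m) root)
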